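{- Let $S_1,S_2$ be stations and let $F$ be an array of connections from $S_1$ to $S_2$, all operating daily, ordered primarily by departure time, secondarily by arrival time, and then with critical arrivals before non-critical arrivals; consider its outrolled array (the concatenation of copies of $F$ with all times shifted by $1440\cdot j$ for $j=0,1,2,\dots$). Let $P$ be an arrival connection at station $S_1$ that can be linked with a connection $Q$ of the outrolled array with a transfer, i.e. $arr(P)+\mathit{transfer}(S_1)\le dep(Q)$. Let $d:=\mathit{length}(Q)-\min_{Q''\in F}\mathit{length}(Q'')$. Then every connection $Q'$ that comes later than $Q$ in the outrolled array and whose link with $P$ is not dominated by the arrival connection obtained by linking $P$ with $Q$ satisfies $dep(Q')< dep(Q)+d+\mathit{transfer}(S_2)$.
   Context: Timetable setting: stations with minimum transfer times $\mathit{transfer}(S)$; stop events; elementary connections $(Z_1,Z_2,S_1,S_2,t_d,t_a)$ meaning a train leaves $S_1$ at $t_d$ after stop event $Z_1$ and next stops at stop event $Z_2$ at $S_2$ at $t_a$ (minutes in $[0,1439]$). A connection $P$ (a consistent sequence of elementary connections with absolute times, where consecutive legs either continue the same train or respect the transfer time at the transfer station) has departure time $dep(P)$, arrival time $arr(P)$, $\mathit{length}(P)=arr(P)-dep(P)$, final stop event $Z_2(P)$ and final station $S_2(P)$. $ndep(P)$ is the departure time of stop event $Z_2(P)$ at $S_2(P)$ (the train's next departure), or $\perp$ if the train ends there; $P$ has a critical arrival if $ndep(P)\ne\perp$ and $ndep(P)-arr(P)<\mathit{transfer}(S_2(P))$. An arrival connection at a station is a connection from a fixed source station (departing no earlier than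 a fixed query time), represented by its arrival time and final stop event. Linking an arrival connection $P$ at $S_1$ with a connection $Q$ from $S_1$ to $S_2$ with a transfer (allowed when $arr(P)+\mathit{transfer}(S_1)\le dep(Q)$) yields the arrival connection at $S_2$ with arrival time $arr(Q)$ and stop event $Z_2(Q)$. Arrival connection $X$ dominates arrival connection $Y$ iff they end at the same station, $arr(X)\le arr(Y)$, and ($Z_2(Y)=Z_2(X)$, or $Y$ has no critical arrival, or $ndep(Y)-arr(X)\ge\mathit{transfer}$ of that station). -}

module Defs where

open import Data.Nat using (ℕ; _+_; _*_; _∸_; _≤_; _<_; _⊓_)
open import Data.Fin using (Fin; toℕ)
open import Data.Vec using (Vec; lookup; foldr₁)
open import Data.Maybe using (Maybe; just; nothing; map)
open import Data.Product using (Σ; _×_; _,_)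
open import Data.Sum using (_⊎_)
open import Relation.Nullary using (¬_)
open import Relation.Binary.PropositionalEquality using (_≡_)

-- A connection between two (fixed, implicit) stations, with absolute times
-- in minutes.  Z is the type of (final) stop events.
record Conn (Z : Set) : Set where
  field
    dep  : ℕ
    arr  : ℕ
    z2   : Z
    ndep : Maybe ℕ    -- ndep(P) (absolute time), nothing = ⊥
open Conn public

len : ∀ {Z} → Conn Z → ℕ
len c = arr c ∸ dep c

record WellFormed {Z : Set} (c : Conn Z) : Set where
  field
    dep≤arr   : dep c ≤ arr c
    dep<day   : dep c < 1440
    arr≤ndep  : ∀ n → ndep c ≡ just n → arr c ≤ n

-- critical arrival w.r.t. the transfer time t of the final station
Critical : ∀ {Z} → ℕ → Conn Z → Set
Critical t c = Σ ℕ λ n → ndep c ≡ just n × (n ∸ arr c < t)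

OrderedPair : ∀ {Z} → ℕ → Conn Z → Conn Z → Set
OrderedPair t a b =
  dep a < dep b ⊎
  (dep a ≡ dep b × (arr a < arr b ⊎ (arr a ≡ arr b × (Critical t a ⊎ ¬ Critical t b))))

Sorted : ∀ {Z n} → ℕ → Vec (Conn Z) n → Set
Sorted {n = n} t F = (i k : Fin n) → toℕ i < toℕ k → OrderedPair t (lookup F i) (lookup F k)

shift : ∀ {Z} → ℕ → Conn Z → Conn (Z × ℕ)
shift j c = record
  { dep = dep c + 1440 * j
  ; arr = arr c + 1440 * j
  ; z2 = (z2 c , j)
  ; ndep = map (λ n → n + 1440 * j) (ndep c) }

-- the outrolled array, indexed by (copy j, position i)
outrolled : ∀ {Z n} → Vec (Conn Z) n → ℕ → Fin n → Conn (Z × ℕ)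
outrolled F j i = shift j (lookup F i)

Later : ∀ {n} → ℕ → Fin n → ℕ → Fin n → Set
Later j i j' i' = j < j' ⊎ (j ≡ j' × toℕ i < toℕ i')

minLength : ∀ {Z m} → Vec (Conn Z) (Data.Nat.suc m) → ℕ
minLength F = foldr₁ _⊓_ (Data.Vec.map len F)

record ArrConn (Z : Set) : Set where
  field
    aArr  : ℕ
    aZ2   : Z
    aNdep : Maybe ℕ
open ArrConn public

link : ∀ {Z} → ArrConn Z → Conn Z → ArrConn Z
link P Q = record { aArr = arr Q ; aZ2 = z2 Q ; aNdep = ndep Q }

CanLink : ∀ {Z} → ℕ → ArrConn Z → Conn Z → Set
CanLink t₁ P Q = aArr P + t₁ ≤ dep Q

CriticalA : ∀ {Z} → ℕ → ArrConn Z → Set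
CriticalA t y = Σ ℕ λ n → aNdep y ≡ just n × (n ∸ aArr y < t)

Dominates : ∀ {Z} → ℕ → ArrConn Z → ArrConn Z → Set
Dominates t X Y =
  aArr X ≤ aArr Y ×
  (aZ2 Y ≡ aZ2 X ⊎ ¬ CriticalA t Y ⊎
   (Σ ℕ λ n → aNdep Y ≡ just n × aArr X + t ≤ n))

module Submission where

-- Write Q for the connection at position (j , i) of the outrolled
-- array, Q' for a later one, M for the minimal length of a connection of F and
-- t for the transfer time at S₂.  Every connection of the outrolled array is a
-- shifted copy of a connection of F, so its length is at least M.  Suppose
-- dep Q' ≥ dep Q + (length Q - M) + t.  Then
--   arr Q' = dep Q' + length Q' ≥ dep Q + length Q + t = arr Q + t,
-- so arr(link P Q) + t ≤ arr(link P Q'), and since a train never departs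
-- before it arrives, ndep Q' (if defined) is at least arr(link P Q) + t too.
-- Hence link P Q dominates link P Q', contradicting the hypothesis; as the
-- order on ℕ is decidable, dep Q' lies below the bound.

open import Defs
open import Data.Nat using (ℕ; suc; _+_; _*_; _∸_; _<_; _≤_; _⊓_; _<?_)
open import Data.Nat.Properties
open import Data.Fin using (Fin; zero; suc)
open import Data.Vec using (Vec; lookup; foldr₁; _∷_; [])
import Data.Vec as Vec
open import Data.Vec.Properties using (lookup-map)
open import Data.Maybe using (just; nothing)
open import Data.Product using (_×_; _,_)
open import Data.Sum using (inj₁; inj₂)
open import Data.Empty using (⊥-elim)
open import Relation.Nullary using (¬_; yes; no)
open import Relation.Binary.PropositionalEquality
  using (_≡_; refl; sym; cong; cong₂; subst; module ≡-Reasoning)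

foldr₁-⊓-≤-lookup : ∀ {m} (v : Vec ℕ (suc m)) (i : Fin (suc m)) →
                    foldr₁ _⊓_ v ≤ lookup v i
foldr₁-⊓-≤-lookup (x ∷ [])     zero    = ≤-refl
foldr₁-⊓-≤-lookup (x ∷ y ∷ ys) zero    = m⊓n≤m x _
foldr₁-⊓-≤-lookup (x ∷ y ∷ ys) (suc i) =
  ≤-trans (m⊓n≤n x _) (foldr₁-⊓-≤-lookup (y ∷ ys) i)

len-shift : ∀ {Z} (j : ℕ) (c : Conn Z) → len (shift j c) ≡ len c
len-shift j c = begin
  (arr c + d) ∸ (dep c + d) ≡⟨ cong₂ _∸_ (+-comm (arr c) d) (+-comm (dep c) d) ⟩
  (d + arr c) ∸ (d + dep c) ≡⟨ [m+n]∸[m+o]≡n∸o d (arr c) (dep c) ⟩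
  arr c ∸ dep c             ∎
  where
  d = 1440 * j
  open ≡-Reasoning

minLength-≤-outrolled : ∀ {Z m} (F : Vec (Conn Z) (suc m)) (j : ℕ) (i : Fin (suc m)) →
                        minLength F ≤ len (outrolled F j i)
minLength-≤-outrolled F j i =
  subst (minLength F ≤_) length-eq (foldr₁-⊓-≤-lookup (Vec.map len F) i)
  where
  length-eq : lookup (Vec.map len F) i ≡ len (outrolled F j i)
  length-eq = begin
    lookup (Vec.map len F) i  ≡⟨ lookup-map i len F ⟩
    len (lookup F i)          ≡⟨ sym (len-shift j (lookup F i)) ⟩
    len (outrolled F j i)     ∎
    where open ≡-Reasoning

shift-dep≤arr : ∀ {Z} (j : ℕ) {c : Conn Z} → WellFormed c → dep (shift j c) ≤ arr (shift j c)
shift-dep≤arr j w = +-monoˡ-≤ (1440 * j) (WellFormed.dep≤arr w)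

shift-arr≤ndep : ∀ {Z} (j : ℕ) {c : Conn Z} → WellFormed c →
                 ∀ n → ndep (shift j c) ≡ just n → arr (shift j c) ≤ n
shift-arr≤ndep j {c} w n eq with ndep c in ndep≡
shift-arr≤ndep j {c} w _ refl | just n =
  +-monoˡ-≤ (1440 * j) (WellFormed.arr≤ndep w n ndep≡)

late-departure⇒late-arrival : ∀ {a L a' L' M t : ℕ} → M ≤ L → M ≤ L' →
                              a + (L ∸ M) + t ≤ a' → a + L + t ≤ a' + L'
late-departure⇒late-arrival {a} {L} {a'} {L'} {M} {t} M≤L M≤L' late = begin
  a + L + t                 ≡⟨ cong (λ x → a + x + t) (sym (m∸n+n≡m M≤L)) ⟩
  a + (L ∸ M + M) + t       ≡⟨ reassoc a (L ∸ M) t M ⟩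
  a + (L ∸ M) + t + M       ≤⟨ +-mono-≤ late M≤L' ⟩
  a' + L'                   ∎
  where
  open ≤-Reasoning
  reassoc : ∀ a x t m → a + (x + m) + t ≡ a + x + t + m
  reassoc a x t m = begin-equality
    a + (x + m) + t   ≡⟨ cong (_+ t) (sym (+-assoc a x m)) ⟩
    a + x + m + t     ≡⟨ +-assoc (a + x) m t ⟩
    a + x + (m + t)   ≡⟨ cong (a + x +_) (+-comm m t) ⟩
    a + x + (t + m)   ≡⟨ sym (+-assoc (a + x) t m) ⟩
    a + x + t + m     ∎

arr≡dep+len : ∀ {Z} (c : Conn Z) → dep c ≤ arr c → arr c ≡ dep c + len c
arr≡dep+len c dep≤arr = sym (m+[n∸m]≡n dep≤arr)

late-arrival⇒dominates : ∀ {Z} (t : ℕ) (X Y : ArrConn Z) →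
                         aArr X + t ≤ aArr Y →
                         (∀ n → aNdep Y ≡ just n → aArr Y ≤ n) →
                         Dominates t X Y
late-arrival⇒dominates t X record { aNdep = nothing } late _ =
  ≤-trans (m≤m+n (aArr X) t) late , inj₂ (inj₁ λ { (_ , () , _) })
late-arrival⇒dominates t X record { aNdep = just n } late arr≤ndep =
  ≤-trans (m≤m+n (aArr X) t) late , inj₂ (inj₂ (n , refl , ≤-trans late (arr≤ndep n refl)))

late-departure⇒dominates : ∀ {Z} (t M : ℕ) (P : ArrConn Z) (Q Q' : Conn Z) →
                           dep Q ≤ arr Q → dep Q' ≤ arr Q' →
                           (∀ n → ndep Q' ≡ just n → arr Q' ≤ n) →
                           M ≤ len Q → M ≤ len Q' →
                           dep Q + (len Q ∸ M) + t ≤ dep Q' →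
                           Dominates t (link P Q) (link P Q')
late-departure⇒dominates t M P Q Q' Q-ok Q'-ok arr≤ndep M≤L M≤L' late =
  late-arrival⇒dominates t (link P Q) (link P Q') Q'-arrives-late arr≤ndep
  where
  open ≤-Reasoning
  Q'-arrives-late : arr Q + t ≤ arr Q'
  Q'-arrives-late = begin
    arr Q + t              ≡⟨ cong (_+ t) (arr≡dep+len Q Q-ok) ⟩
    dep Q + len Q + t      ≤⟨ late-departure⇒late-arrival {dep Q} {len Q} {dep Q'} {len Q'} {M} {t}
                                M≤L M≤L' late ⟩
    dep Q' + len Q'        ≡⟨ sym (arr≡dep+len Q' Q'-ok) ⟩
    arr Q'                 ∎

lemma3 : {Station Z : Set} (transfer : Station → ℕ) (S₁ S₂ : Station)
         {m : ℕ} (F : Vec (Conn Z) (suc m))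
         → ((i : Fin (suc m)) → WellFormed (lookup F i))
         → Sorted (transfer S₂) F
         → (P : ArrConn (Z × ℕ))
         → (j : ℕ) (i : Fin (suc m))
         → CanLink (transfer S₁) P (outrolled F j i)
         → (j' : ℕ) (i' : Fin (suc m))
         → Later j i j' i'
         → ¬ Dominates (transfer S₂) (link P (outrolled F j i)) (link P (outrolled F j' i'))
         → dep (outrolled F j' i')
           < dep (outrolled F j i) + (len (outrolled F j i) ∸ minLength F) + transfer S₂
lemma3 transfer S₁ S₂ F wf _ P j i _ j' i' _ not-dominated
  with dep (outrolled F j' i') <? dep (outrolled F j i) + (len (outrolled F j i) ∸ minLength F) + transfer S₂
... | yes early = early
... | no not-early = ⊥-elim (not-dominated
        (late-departure⇒dominates (transfer S₂) (minLength F) P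
           (outrolled F j i) (outrolled F j' i')
           (shift-dep≤arr j (wf i)) (shift-dep≤arr j' (wf i')) (shift-arr≤ndep j' (wf i'))
           (minLength-≤-outrolled F j i) (minLength-≤-outrolled F j' i')
           (≮⇒≥ not-early)))
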